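{- Let $\mathcal{M}=(S,\rightarrow,\ell)$ be an image-finite WTS and $s\in S$. Let $T\subseteq S$ be a set such that all elements of $T$ satisfy exactly the same formulae of $\mathcal{L}$, and such that for every $t\in T$ and every $t'\in S\setminus T$ there exists a formula $\varphi\in\mathcal{L}$ with $\mathcal{M},t\models\varphi$ and $\mathcal{M},t'\not\models\varphi$. Then there exists a formula $\varphi\in\mathcal{L}$ such that $\theta(s)(T)=\theta(s)([\![\varphi]\!])$.
   Context: Fix a countable set $\mathcal{AP}$ of atomic propositions. A weighted transition system (WTS) is a triple $\mathcal{M}=(S,\rightarrow,\ell)$ where $S$ is a non-empty set of states, $\rightarrow\subseteq S\times\mathbb{R}_{\ge 0}\times S$ is a transition relation (write $s\xrightarrow{r}t$), and $\ell:S\to 2^{\mathcal{AP}}$ is a labeling. $\mathcal{M}$ is image-finite if for every $s\in S$ there are only finitely many $t\in S$ with $s\xrightarrow{r}t$ for some $r$. For $s\in S$, $T\subseteq S$ let $\theta(s)(T)=\{r\mid \exists t\in T,\ s\xrightarrow{r}t\}$; $\theta^-(s)(T)=-\infty$ if $\theta(s)(T)=\emptyset$, else $\inf\theta(s)(T)$; $\theta^+(s)(T)=\infty$ if $\theta(s)(T)=\emptyset$, else $\sup\theta(s)(T)$. Formulae of $\mathcal{L}$: $\varphi::= p\mid\neg\varphi\mid\varphi\wedge\varphi\mid L_r\varphi\mid M_r\varphi$ with $p\in\mathcal{AP}$, $r\in\mathbb{Q}_{\ge0}$. Semantics: $\mathcal{M},s\models p$ iff $p\in\ell(s)$; Boolean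 cases as usual; $\mathcal{M},s\models L_r\varphi$ iff $\theta^-(s)([\![\varphi]\!])\ge r$; $\mathcal{M},s\models M_r\varphi$ iff $\theta^+(s)([\![\varphi]\!])\le r$, where $[\![\varphi]\!]=\{s\in S\mid\mathcal{M},s\models\varphi\}$. -}

module Defs where

open import Level using (0ℓ)
open import Data.Nat using (ℕ)
open import Data.Rational using (ℚ; 0ℚ) renaming (_≤_ to _≤ℚ_)
open import Data.Product using (Σ; ∃; _×_)
open import Data.List using (List)
open import Data.List.Membership.Propositional using (_∈_)
open import Relation.Nullary using (¬_)
open import Relation.Binary.PropositionalEquality using (_≡_)
open import Relation.Binary.Structures using (IsTotalOrder)

-- Abstract stand-in for the real numbers (agda-stdlib has no reals):
-- a totally ordered carrier W together with an order-preserving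
-- embedding of the rationals.
record WeightDomain : Set₁ where
  field
    W            : Set
    _≤_          : W → W → Set
    isTotalOrder : IsTotalOrder _≡_ _≤_
    ι            : ℚ → W
    ι-mono       : ∀ {p q} → p ≤ℚ q → ι p ≤ ι q

AP : Set
AP = ℕ

data Form : Set where
  atom : AP → Form
  neg  : Form → Form
  and  : Form → Form → Form
  L    : (r : ℚ) → 0ℚ ≤ℚ r → Form → Form
  M    : (r : ℚ) → 0ℚ ≤ℚ r → Form → Form

record WTS (D : WeightDomain) : Set₁ where
  open WeightDomain D
  field
    S       : Set
    _⟶[_]_  : S → W → S → Set
    ℓ       : S → AP → Set           -- ℓ s p  ⇔  p ∈ ℓ(s)
    nonneg  : ∀ {s r t} → s ⟶[ r ] t → ι 0ℚ ≤ r

module _ {D : WeightDomain} (𝓜 : WTS D) where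
  open WeightDomain D
  open WTS 𝓜

  ImageFinite : Set
  ImageFinite = ∀ s → Σ (List S) λ xs → ∀ {r t} → s ⟶[ r ] t → t ∈ xs

  -- θ(s)(T) as a predicate on weights: r ∈ θ(s)(T)
  θ : S → (S → Set) → W → Set
  θ s T r = ∃ λ t → T t × s ⟶[ r ] t

  -- L_r φ : θ⁻(s)(⟦φ⟧) ≥ r, i.e. θ(s)(⟦φ⟧) nonempty (else θ⁻ = -∞)
  --         and its infimum is ≥ r, i.e. every element is ≥ r.
  -- M_r φ : θ⁺(s)(⟦φ⟧) ≤ r, i.e. θ(s)(⟦φ⟧) nonempty (else θ⁺ = ∞)
  --         and its supremum is ≤ r, i.e. every element is ≤ r.
  _⊨_ : S → Form → Set
  s ⊨ atom p    = ℓ s p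
  s ⊨ neg φ     = ¬ (s ⊨ φ)
  s ⊨ and φ ψ   = (s ⊨ φ) × (s ⊨ ψ)
  s ⊨ L r _ φ   = (∃ λ w → ∃ λ t → (t ⊨ φ) × s ⟶[ w ] t)
                × (∀ w t → (t ⊨ φ) → s ⟶[ w ] t → ι r ≤ w)
  s ⊨ M r _ φ   = (∃ λ w → ∃ λ t → (t ⊨ φ) × s ⟶[ w ] t)
                × (∀ w t → (t ⊨ φ) → s ⟶[ w ] t → w ≤ ι r)

  ⟦_⟧ : Form → S → Set
  ⟦ φ ⟧ t = t ⊨ φ

module Submission where

-- If T is empty, the contradictory formula ⊥F has empty
-- extension, so θ(s)(T) = ∅ = θ(s)(⟦⊥F⟧).  Otherwise fix t₀ ∈ T.  By
-- image-finiteness the successors of s lie in a finite list xs.  For each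
-- x in xs choose a formula true at t₀ and false at x whenever x ∉ T
-- (excluded middle decides T x: the trivial formula ⊤F if x ∈ T, the
-- given distinguishing formula otherwise); their conjunction φ is true at
-- t₀ and false at every successor of s outside T.  Since all elements of
-- T satisfy the same formulae as t₀, φ holds on all of T; so T and ⟦φ⟧
-- agree on the successors of s, and θ(s) only sees successors.

open import Defs
open import Level using (0ℓ)
open import Axiom.ExcludedMiddle using (ExcludedMiddle)
open import Data.Product using (∃; _×_; _,_; proj₁; proj₂)
open import Relation.Nullary using (¬_; yes; no)
open import Function.Bundles using (_⇔_; mk⇔; Equivalence)
open import Data.List using (List; []; _∷_)
open import Data.List.Membership.Propositional using (_∈_)
open import Data.List.Relation.Unary.Any using (here; there)
open import Relation.Binary.PropositionalEquality using (refl)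
open import Data.Empty using (⊥-elim)

⊥F : Form
⊥F = and (atom 0) (neg (atom 0))

⊤F : Form
⊤F = neg ⊥F

module Lemmas {D : WeightDomain} (𝓜 : WTS D) where
  open WTS 𝓜

  infix 4 _⊩_
  _⊩_ : S → Form → Set
  _⊩_ = _⊨_ 𝓜

  ⊮⊥F : ∀ t → ¬ t ⊩ ⊥F
  ⊮⊥F t (p , ¬p) = ¬p p

  ⊩⊤F : ∀ t → t ⊩ ⊤F
  ⊩⊤F = ⊮⊥F

  θ-cong : ∀ s (U V : S → Set) →
           (∀ {r t} → s ⟶[ r ] t → U t → V t) →
           (∀ {r t} → s ⟶[ r ] t → V t → U t) →
           ∀ r → θ 𝓜 s U r ⇔ θ 𝓜 s V r
  θ-cong s U V U⇒V V⇒U r =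
    mk⇔ (λ { (t , Ut , st) → t , U⇒V st Ut , st })
        (λ { (t , Vt , st) → t , V⇒U st Vt , st })

  separate : ∀ t₀ (Bad : S → Set) (xs : List S) →
             (∀ {x} → x ∈ xs → ∃ λ φ → t₀ ⊩ φ × (Bad x → ¬ x ⊩ φ)) →
             ∃ λ φ → t₀ ⊩ φ × (∀ {x} → x ∈ xs → Bad x → ¬ x ⊩ φ)
  separate t₀ Bad [] _ = ⊤F , ⊩⊤F t₀ , λ ()
  separate t₀ Bad (y ∷ xs) sep
    with sep (here refl) | separate t₀ Bad xs (λ x∈xs → sep (there x∈xs))
  ... | φ , t₀⊩φ , φ-sep | ψ , t₀⊩ψ , ψ-sep =
    and φ ψ , (t₀⊩φ , t₀⊩ψ) , and-sep
    where
      and-sep : ∀ {x} → x ∈ y ∷ xs → Bad x → ¬ x ⊩ and φ ψ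
      and-sep (here refl) bad (x⊩φ , _) = φ-sep bad x⊩φ
      and-sep (there x∈xs) bad (_ , x⊩ψ) = ψ-sep x∈xs bad x⊩ψ

  separator : ExcludedMiddle 0ℓ → (T : S → Set) → ∀ t₀ →
              (∀ x → ¬ T x → ∃ λ φ → t₀ ⊩ φ × ¬ x ⊩ φ) →
              ∀ x → ∃ λ φ → t₀ ⊩ φ × (¬ T x → ¬ x ⊩ φ)
  separator em T t₀ dist x with em {T x}
  ... | yes Tx = ⊤F , ⊩⊤F t₀ , λ ¬Tx _ → ¬Tx Tx
  ... | no ¬Tx with dist x ¬Tx
  ...   | φ , t₀⊩φ , x⊮φ = φ , t₀⊩φ , λ _ → x⊮φ

  stable : ExcludedMiddle 0ℓ → {P : Set} → ¬ ¬ P → P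
  stable em {P} ¬¬P with em {P}
  ... | yes p = p
  ... | no ¬p = ⊥-elim (¬¬P ¬p)

lemma3p4 : ExcludedMiddle 0ℓ →
    {D : WeightDomain} (𝓜 : WTS D) → ImageFinite 𝓜 →
    (s : WTS.S 𝓜) (T : WTS.S 𝓜 → Set) →
    (∀ t t' → T t → T t' → ∀ φ → (_⊨_ 𝓜 t φ ⇔ _⊨_ 𝓜 t' φ)) →
    (∀ t t' → T t → ¬ T t' → ∃ λ φ → _⊨_ 𝓜 t φ × ¬ _⊨_ 𝓜 t' φ) →
    ∃ λ φ → ∀ r → θ 𝓜 s T r ⇔ θ 𝓜 s (⟦_⟧ 𝓜 φ) r
lemma3p4 em 𝓜 imf s T same dist with em {∃ T}
... | no T-empty =
  ⊥F , θ-cong s T (⟦_⟧ 𝓜 ⊥F) (λ _ Tt → ⊥-elim (T-empty (_ , Tt)))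
                             (λ _ t⊩⊥F → ⊥-elim (⊮⊥F _ t⊩⊥F))
  where open Lemmas 𝓜
... | yes (t₀ , Tt₀) = φ , θ-cong s T (⟦_⟧ 𝓜 φ) T⇒φ φ⇒T
  where
    open Lemmas 𝓜
    open WTS 𝓜 using (S; _⟶[_]_)

    succs : List S
    succs = proj₁ (imf s)

    separation : ∃ λ φ → t₀ ⊩ φ × (∀ {x} → x ∈ succs → ¬ T x → ¬ x ⊩ φ)
    separation = separate t₀ (λ x → ¬ T x) succs
                   (λ {x} _ → separator em T t₀ (λ x' → dist t₀ x' Tt₀) x)

    φ : Form
    φ = proj₁ separation

    T⇒φ : ∀ {r t} → s ⟶[ r ] t → T t → t ⊩ φ
    T⇒φ {t = t} _ Tt = Equivalence.to (same t₀ t Tt₀ Tt φ) (proj₁ (proj₂ separation))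

    φ⇒T : ∀ {r t} → s ⟶[ r ] t → t ⊩ φ → T t
    φ⇒T st t⊩φ = stable em λ ¬Tt → proj₂ (proj₂ separation) (proj₂ (imf s) st) ¬Tt t⊩φ
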